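{- Let $a\in\Sigma$ and let $v_1,v_2,v_3,v_4\in\Sigma^*$ with $|v_1v_2v_3v_4|_a=0$. Let $w=v_1av_2av_3av_4$ and $w'=v_1v_2av_3v_4$, and suppose $|w|_b\le 2$ for every letter $b\in\Sigma$ with $b\ne a$. Then $SP(w)\le 2SP(w')+1$.
   Context: $|u|_x$ denotes the number of occurrences of the letter $x$ in the word $u$; $\Sigma^*$ is the set of finite words over $\Sigma$. A scattered subword of $w$ is a (not necessarily contiguous) subsequence of $w$. A palindrome is a word equal to its reversal. $SP(w)$ is the number of distinct non-empty palindromes that are scattered subwords of $w$. -}

module Defs where

open import Data.Nat using (ℕ)
open import Data.List using (List; []; _∷_; _++_; map; filter; length; reverse; deduplicate)
open import Data.List.Properties using (≡-dec)
open import Relation.Binary.Definitions using (DecidableEquality)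
open import Relation.Binary.PropositionalEquality using (_≡_)
open import Relation.Nullary using (¬_; Dec; yes; no)
open import Relation.Nullary.Decidable using (_×-dec_; ¬?)

subwords : {A : Set} → List A → List (List A)
subwords []       = [] ∷ []
subwords (x ∷ xs) = map (x ∷_) (subwords xs) ++ subwords xs

count : {A : Set} → DecidableEquality A → A → List A → ℕ
count _≟_ x u = length (filter (x ≟_) u)

IsPalindrome : {A : Set} → List A → Set
IsPalindrome u = u ≡ reverse u

isPalindrome? : {A : Set} → DecidableEquality A → (u : List A) → Dec (IsPalindrome u)
isPalindrome? _≟_ u = ≡-dec _≟_ u (reverse u)

NonEmpty : {A : Set} → List A → Set
NonEmpty u = ¬ (u ≡ [])

nonEmpty? : {A : Set} → DecidableEquality A → (u : List A) → Dec (NonEmpty u)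
nonEmpty? _≟_ u = ¬? (≡-dec _≟_ u [])

SP : {A : Set} → DecidableEquality A → List A → ℕ
SP _≟_ w =
  length (deduplicate (≡-dec _≟_)
    (filter (λ u → nonEmpty? _≟_ u ×-dec isPalindrome? _≟_ u) (subwords w)))

-- A palindromic subword p of w = v₁av₂av₃av₄ that is not a subword of w′ = v₁v₂av₃v₄
-- contains a, at most three times and symmetrically placed, so p is u a uᴿ, y a s a yᴿ or
-- y a s a sᴿ a yᴿ with u, y, s free of a. Deleting the first and the last a of p gives a
-- non-empty palindromic subword of w′ unless p = aa, and this deletion is injective: if two
-- such p collide, their outer a-free parts differ by a letter c ≠ a occurring on both sides
-- of the centre; since c occurs at most twice in w, both embeddings pass through the same two
-- occurrences of c, and exchanging their middle blocks either embeds p into w′ or yields a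
-- subword of w with four a's. Hence SP(w) ≤ SP(w′) + SP(w′) + 1.
module Submission where

open import Defs
open import Data.Nat using (ℕ; zero; suc; _≤_; _*_; _+_; z≤n; s≤s; s≤s⁻¹) renaming (_≟_ to _≟ℕ_)
open import Data.Nat.Properties using (+-comm; +-suc; +-mono-≤; ≤-trans; <⇒≢; m≤n+m; n≤0⇒n≡0; m+n≡0⇒m≡0; m+n≡0⇒n≡0; m+n≤o⇒m≤o; m+n≤o⇒n≤o)
open import Data.Nat.Solver using (module +-*-Solver)
open import Data.List using (List; []; _∷_; _++_; [_]; length; reverse; filter; map; deduplicate)
open import Data.List.Properties using (≡-dec; ∷-injective; ++-assoc; ++-identityʳ; ++-cancelʳ; ++-monoid; length-map; length-++; length-++-≤ʳ; length-++-sucʳ; filter-++; unfold-reverse; reverse-++; reverse-involutive)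
open import Data.List.Membership.Propositional using (_∈_)
open import Data.List.Membership.Propositional.Properties using (∈-++⁻; ∈-++⁺ˡ; ∈-++⁺ʳ; ∈-∃++; ∈-map⁺; ∈-map⁻; ∈-filter⁺; ∈-filter⁻; ∈-deduplicate⁺; ∈-deduplicate⁻)
open import Data.List.Relation.Unary.Any using (here; there)
import Data.List.Relation.Unary.All as All
open import Data.List.Relation.Unary.Unique.Propositional using (Unique; _∷_)
open import Data.List.Relation.Unary.Unique.DecPropositional.Properties using (deduplicate-!)
open import Data.Product using (∃-syntax; _×_; _,_; proj₁; proj₂)
open import Data.Sum using (_⊎_; inj₁; inj₂)
open import Data.Empty using (⊥; ⊥-elim)
open import Function using (_∘_)
open import Relation.Binary.Definitions using (DecidableEquality)
open import Relation.Binary.PropositionalEquality using (_≡_; _≢_; refl; sym; trans; cong; cong₂; subst; module ≡-Reasoning)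
open import Relation.Nullary using (¬_; Dec; yes; no)
open import Relation.Nullary.Decidable using (_×-dec_)

module _ {X Y : Set} (f : X → Y) where

  length-≤-of-injective : ∀ xs ys → Unique xs → (∀ {x} → x ∈ xs → f x ∈ ys) →
                          (∀ {x x′} → x ∈ xs → x′ ∈ xs → f x ≡ f x′ → x ≡ x′) → length xs ≤ length ys
  length-≤-of-injective [] ys _ _ _ = z≤n
  length-≤-of-injective (x ∷ xs) ys (x∉xs ∷ unique) into injective with ∈-∃++ (into (here refl))
  ... | ys₁ , ys₂ , refl =
    subst (suc (length xs) ≤_) (sym (length-++-sucʳ ys₁ (f x) ys₂))
      (s≤s (length-≤-of-injective xs (ys₁ ++ ys₂) unique into′ (λ m m′ → injective (there m) (there m′))))
    where
      into′ : ∀ {x′} → x′ ∈ xs → f x′ ∈ ys₁ ++ ys₂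
      into′ m with ∈-++⁻ ys₁ (into (there m))
      ... | inj₁ m₁ = ∈-++⁺ˡ m₁
      ... | inj₂ (here fx′≡fx) = ⊥-elim (All.lookup x∉xs m (sym (injective (there m) (here refl) fx′≡fx)))
      ... | inj₂ (there m₂) = ∈-++⁺ʳ ys₁ m₂

module Words {A : Set} (_≟_ : DecidableEquality A) where

  open import Data.List.Relation.Binary.Sublist.DecPropositional _≟_ public
    using (_⊆_; []; _∷_; _∷ʳ_; _⊆?_; ⊆-refl; ⊆-trans)
  open import Data.List.Relation.Binary.Sublist.Propositional.Properties public
    using (++⁺; ++⁺ˡ; ++⁺ʳ; ∷ˡ⁻; reverse⁺; []⊆-universal)
  open import Data.List.Relation.Binary.Sublist.Propositional.Properties
    using (filter⁺; length-mono-≤)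

  occ : A → List A → ℕ
  occ c u = count _≟_ c u

  Free : A → List A → Set
  Free c u = occ c u ≡ 0

  occ-++ : ∀ c u v → occ c (u ++ v) ≡ occ c u + occ c v
  occ-++ c u v = trans (cong length (filter-++ (c ≟_) u v)) (length-++ (filter (c ≟_) u))

  occ-here : ∀ c u → occ c (c ∷ u) ≡ suc (occ c u)
  occ-here c u with c ≟ c
  ... | yes _ = refl
  ... | no c≢c = ⊥-elim (c≢c refl)

  occ-there : ∀ {c x} u → c ≢ x → occ c (x ∷ u) ≡ occ c u
  occ-there {c} {x} u c≢x with c ≟ x
  ... | yes c≡x = ⊥-elim (c≢x c≡x)
  ... | no _ = refl

  occ-mid : ∀ c u v → occ c (u ++ c ∷ v) ≡ occ c u + suc (occ c v)
  occ-mid c u v = trans (occ-++ c u (c ∷ v)) (cong (occ c u +_) (occ-here c v))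

  reverse-mid : ∀ (c : A) xs ys → reverse (xs ++ c ∷ ys) ≡ reverse ys ++ c ∷ reverse xs
  reverse-mid c xs ys rewrite reverse-++ xs (c ∷ ys) | unfold-reverse c ys = ++-assoc (reverse ys) [ c ] (reverse xs)

  occ-reverse : ∀ c u → occ c (reverse u) ≡ occ c u
  occ-reverse c [] = refl
  occ-reverse c (x ∷ u) = begin
    occ c (reverse (x ∷ u))           ≡⟨ cong (occ c) (unfold-reverse x u) ⟩
    occ c (reverse u ++ [ x ])        ≡⟨ occ-++ c (reverse u) [ x ] ⟩
    occ c (reverse u) + occ c [ x ]   ≡⟨ cong (_+ occ c [ x ]) (occ-reverse c u) ⟩
    occ c u + occ c [ x ]             ≡⟨ +-comm (occ c u) (occ c [ x ]) ⟩
    occ c [ x ] + occ c u             ≡⟨ sym (occ-++ c [ x ] u) ⟩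
    occ c (x ∷ u)                     ∎
    where open ≡-Reasoning

  occ-mono : ∀ c {u v} → u ⊆ v → occ c u ≤ occ c v
  occ-mono c u⊆v = length-mono-≤ (filter⁺ (c ≟_) (c ≟_) (λ { refl c≡x → c≡x }) u⊆v)

  free-∷⁻ : ∀ {c x} u → Free c (x ∷ u) → c ≢ x × Free c u
  free-∷⁻ {c} {x} u free with c ≟ x
  ... | no c≢x = c≢x , free

  free-++⁻ : ∀ c u v → Free c (u ++ v) → Free c u × Free c v
  free-++⁻ c u v free = m+n≡0⇒m≡0 (occ c u) free′ , m+n≡0⇒n≡0 (occ c u) free′
    where free′ = trans (sym (occ-++ c u v)) free

  free-++⁺ : ∀ c u v → Free c u → Free c v → Free c (u ++ v)
  free-++⁺ c u v free-u free-v
    rewrite occ-++ c u v | free-u | free-v = refl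

  free-reverse : ∀ c u → Free c u → Free c (reverse u)
  free-reverse c u free = trans (occ-reverse c u) free

  free-mid : ∀ c u v → ¬ Free c (u ++ c ∷ v)
  free-mid c u v free with occ c u | trans (sym (occ-mid c u v)) free
  ... | zero  | ()
  ... | suc _ | ()

  two≤occ : ∀ c xs ys zs → 2 ≤ occ c (xs ++ c ∷ ys ++ c ∷ zs)
  two≤occ c xs ys zs rewrite occ-mid c xs (ys ++ c ∷ zs) | occ-mid c ys zs =
    ≤-trans (s≤s (≤-trans (s≤s z≤n) (m≤n+m (suc (occ c zs)) (occ c ys)))) (m≤n+m _ (occ c xs))

  free-mid⇒≢ : ∀ {c x} xs ys → Free c (xs ++ x ∷ ys) → c ≢ x
  free-mid⇒≢ xs ys free = proj₁ (free-∷⁻ ys (proj₂ (free-++⁻ _ xs (_ ∷ ys) free)))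

  split-++⊆ : ∀ xs {ys zs} → xs ++ ys ⊆ zs → ∃[ z₁ ] ∃[ z₂ ] (zs ≡ z₁ ++ z₂ × xs ⊆ z₁ × ys ⊆ z₂)
  split-++⊆ [] {zs = zs} τ = [] , zs , refl , [] , τ
  split-++⊆ (x ∷ xs) (y ∷ʳ τ) with split-++⊆ (x ∷ xs) τ
  ... | z₁ , z₂ , refl , τ₁ , τ₂ = y ∷ z₁ , z₂ , refl , y ∷ʳ τ₁ , τ₂
  split-++⊆ (x ∷ xs) (refl ∷ τ) with split-++⊆ xs τ
  ... | z₁ , z₂ , refl , τ₁ , τ₂ = x ∷ z₁ , z₂ , refl , refl ∷ τ₁ , τ₂

  split-∷⊆ : ∀ {c ys zs} → c ∷ ys ⊆ zs → ∃[ z₁ ] ∃[ z₂ ] (zs ≡ z₁ ++ c ∷ z₂ × ys ⊆ z₂)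
  split-∷⊆ (y ∷ʳ τ) with split-∷⊆ τ
  ... | z₁ , z₂ , refl , τ′ = y ∷ z₁ , z₂ , refl , τ′
  split-∷⊆ (refl ∷ τ) = [] , _ , refl , τ

  split-at-first-unique : ∀ c α γ {β δ} → Free c α → Free c γ →
                          α ++ c ∷ β ≡ γ ++ c ∷ δ → α ≡ γ × β ≡ δ
  split-at-first-unique c [] [] _ _ refl = refl , refl
  split-at-first-unique c [] (x ∷ γ) _ free-γ refl = ⊥-elim (proj₁ (free-∷⁻ γ free-γ) refl)
  split-at-first-unique c (x ∷ α) [] free-α _ refl = ⊥-elim (proj₁ (free-∷⁻ α free-α) refl)
  split-at-first-unique c (x ∷ α) (y ∷ γ) free-α free-γ eq with ∷-injective eq
  ... | refl , eq′ with split-at-first-unique c α γ (proj₂ (free-∷⁻ α free-α)) (proj₂ (free-∷⁻ γ free-γ)) eq′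
  ...   | refl , refl = refl , refl

  ++-overlap : ∀ (α β γ δ : List A) → α ++ β ≡ γ ++ δ →
               (∃[ t ] (γ ≡ α ++ t × β ≡ t ++ δ)) ⊎ (∃[ t ] (α ≡ γ ++ t × δ ≡ t ++ β))
  ++-overlap [] β γ δ eq = inj₁ (γ , refl , eq)
  ++-overlap (x ∷ α) β [] δ eq = inj₂ (x ∷ α , refl , sym eq)
  ++-overlap (x ∷ α) β (y ∷ γ) δ eq with ∷-injective eq
  ... | refl , eq′ with ++-overlap α β γ δ eq′
  ...   | inj₁ (t , refl , eq″) = inj₁ (t , refl , eq″)
  ...   | inj₂ (t , refl , eq″) = inj₂ (t , refl , eq″)

  Around₂ : A → List A → List A → List A → List A
  Around₂ c W₁ W₂ W₃ = W₁ ++ c ∷ W₂ ++ c ∷ W₃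

  split-around₂ : ∀ c P₁ P₂ P₃ {w} → Around₂ c P₁ P₂ P₃ ⊆ w →
                  ∃[ W₁ ] ∃[ W₂ ] ∃[ W₃ ] (w ≡ Around₂ c W₁ W₂ W₃ × P₁ ⊆ W₁ × P₂ ⊆ W₂ × P₃ ⊆ W₃)
  split-around₂ c P₁ P₂ P₃ τ with split-++⊆ P₁ τ
  ... | z₁ , z₂ , refl , τ₁ , τ′ with split-∷⊆ τ′
  ...   | z₃ , z₄ , refl , τ″ with split-++⊆ P₂ τ″
  ...     | z₅ , z₆ , refl , τ₂ , τ‴ with split-∷⊆ τ‴
  ...       | z₇ , z₈ , refl , τ₃ =
    z₁ ++ z₃ , z₅ ++ z₇ , z₈ , regroup , ++⁺ʳ z₃ τ₁ , ++⁺ʳ z₇ τ₂ , τ₃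
    where
      regroup : z₁ ++ z₃ ++ c ∷ z₅ ++ z₇ ++ c ∷ z₈ ≡ Around₂ c (z₁ ++ z₃) (z₅ ++ z₇) z₈
      regroup = trans (sym (++-assoc z₁ z₃ _)) (cong (λ t → (z₁ ++ z₃) ++ c ∷ t) (sym (++-assoc z₅ z₇ _)))

  occ-around₂ : ∀ c W₁ W₂ W₃ → occ c (Around₂ c W₁ W₂ W₃) ≡ occ c W₁ + suc (occ c W₂ + suc (occ c W₃))
  occ-around₂ c W₁ W₂ W₃ rewrite occ-mid c W₁ (W₂ ++ c ∷ W₃) | occ-mid c W₂ W₃ = refl

  occ-around₂-≢ : ∀ {b} c W₁ W₂ W₃ → b ≢ c → occ b (Around₂ c W₁ W₂ W₃) ≡ occ b W₁ + (occ b W₂ + occ b W₃)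
  occ-around₂-≢ {b} c W₁ W₂ W₃ b≢c
    rewrite occ-++ b W₁ (c ∷ W₂ ++ c ∷ W₃) | occ-there (W₂ ++ c ∷ W₃) b≢c
          | occ-++ b W₂ (c ∷ W₃) | occ-there W₃ b≢c = refl

  around₂-free : ∀ c W₁ W₂ W₃ → occ c (Around₂ c W₁ W₂ W₃) ≤ 2 → Free c W₁ × Free c W₂ × Free c W₃
  around₂-free c W₁ W₂ W₃ le = zeros (occ c W₁) (occ c W₂) (occ c W₃) (subst (_≤ 2) (occ-around₂ c W₁ W₂ W₃) le)
    where
      zeros : ∀ x y z → x + suc (y + suc z) ≤ 2 → x ≡ 0 × y ≡ 0 × z ≡ 0
      zeros zero zero zero _ = refl , refl , refl
      zeros zero zero (suc z) (s≤s (s≤s ()))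
      zeros zero (suc y) z (s≤s (s≤s le′)) with m+n≤o⇒n≤o y le′
      ... | ()
      zeros (suc x) y z (s≤s le′) with m+n≤o⇒n≤o x le′
      ... | s≤s le″ with m+n≤o⇒n≤o y le″
      ...   | ()

  around₂-unique : ∀ c W₁ W₂ W₃ V₁ V₂ V₃ → occ c (Around₂ c W₁ W₂ W₃) ≤ 2 →
                   Around₂ c W₁ W₂ W₃ ≡ Around₂ c V₁ V₂ V₃ → W₁ ≡ V₁ × W₂ ≡ V₂ × W₃ ≡ V₃
  around₂-unique c W₁ W₂ W₃ V₁ V₂ V₃ le eq
    with around₂-free c W₁ W₂ W₃ le | around₂-free c V₁ V₂ V₃ (subst (λ w → occ c w ≤ 2) eq le)
  ... | f₁ , f₂ , _ | g₁ , g₂ , _ with split-at-first-unique c W₁ V₁ f₁ g₁ eq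
  ...   | refl , eq′ with split-at-first-unique c W₂ V₂ f₂ g₂ eq′
  ...     | refl , refl = refl , refl , refl

  -- Both embeddings pass through the only two occurrences of c in w.
  around₂-mix : ∀ c {w} P₁ P₂ P₃ Q₁ Q₂ Q₃ → occ c w ≤ 2 →
                Around₂ c P₁ P₂ P₃ ⊆ w → Around₂ c Q₁ Q₂ Q₃ ⊆ w → Around₂ c P₁ Q₂ P₃ ⊆ w
  around₂-mix c P₁ P₂ P₃ Q₁ Q₂ Q₃ le τ σ
    with split-around₂ c P₁ P₂ P₃ τ | split-around₂ c Q₁ Q₂ Q₃ σ
  ... | W₁ , W₂ , W₃ , refl , τ₁ , _ , τ₃ | V₁ , V₂ , V₃ , eq , _ , σ₂ , _
    with around₂-unique c W₁ W₂ W₃ V₁ V₂ V₃ le eq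
  ...   | refl , refl , refl = ++⁺ τ₁ (refl ∷ ++⁺ σ₂ (refl ∷ τ₃))

  ⊆-skip-letter : ∀ {c r} α β → Free c r → r ⊆ α ++ c ∷ β → r ⊆ α ++ β
  ⊆-skip-letter [] β _ (_ ∷ʳ τ) = τ
  ⊆-skip-letter {r = _ ∷ r} [] β free (refl ∷ τ) = ⊥-elim (proj₁ (free-∷⁻ r free) refl)
  ⊆-skip-letter (x ∷ α) β free (_ ∷ʳ τ) = x ∷ʳ ⊆-skip-letter α β free τ
  ⊆-skip-letter {r = _ ∷ r} (x ∷ α) β free (refl ∷ τ) = refl ∷ ⊆-skip-letter α β (proj₂ (free-∷⁻ r free)) τ

  ∷⊆-after-free : ∀ {c r T} v → Free c v → c ∷ r ⊆ v ++ c ∷ T → r ⊆ T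
  ∷⊆-after-free [] _ (_ ∷ʳ τ) = ∷ˡ⁻ τ
  ∷⊆-after-free [] _ (refl ∷ τ) = τ
  ∷⊆-after-free (x ∷ v) free (_ ∷ʳ τ) = ∷⊆-after-free v (proj₂ (free-∷⁻ v free)) τ
  ∷⊆-after-free (x ∷ v) free (refl ∷ τ) = ⊥-elim (proj₁ (free-∷⁻ v free) refl)

  ⊆-at-letter : ∀ {c} u v {Z T} → Free c u → Free c v → u ++ c ∷ Z ⊆ v ++ c ∷ T →
                (u ⊆ v × Z ⊆ T) ⊎ (u ++ c ∷ Z ⊆ v ++ T)
  ⊆-at-letter [] [] _ _ (_ ∷ʳ τ) = inj₂ τ
  ⊆-at-letter [] [] _ _ (refl ∷ τ) = inj₁ ([] , τ)
  ⊆-at-letter (x ∷ u) [] _ _ (_ ∷ʳ τ) = inj₂ τ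
  ⊆-at-letter (x ∷ u) [] free-u _ (refl ∷ τ) = ⊥-elim (proj₁ (free-∷⁻ u free-u) refl)
  ⊆-at-letter u (y ∷ v) free-u free-v (_ ∷ʳ τ) with ⊆-at-letter u v free-u (proj₂ (free-∷⁻ v free-v)) τ
  ... | inj₁ (τ₁ , τ₂) = inj₁ (y ∷ʳ τ₁ , τ₂)
  ... | inj₂ τ′ = inj₂ (y ∷ʳ τ′)
  ⊆-at-letter [] (y ∷ v) _ free-v (refl ∷ τ) = ⊥-elim (proj₁ (free-∷⁻ v free-v) refl)
  ⊆-at-letter (x ∷ u) (y ∷ v) free-u free-v (refl ∷ τ)
    with ⊆-at-letter u v (proj₂ (free-∷⁻ u free-u)) (proj₂ (free-∷⁻ v free-v)) τ
  ... | inj₁ (τ₁ , τ₂) = inj₁ (refl ∷ τ₁ , τ₂)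
  ... | inj₂ τ′ = inj₂ (refl ∷ τ′)

  ++-absorbed : ∀ (t s v : List A) → v ≡ t ++ s ++ v → t ≡ [] × s ≡ []
  ++-absorbed [] [] v _ = refl , refl
  ++-absorbed [] (x ∷ s) v eq = ⊥-elim (<⇒≢ (s≤s (length-++-≤ʳ v {s})) (cong length eq))
  ++-absorbed (x ∷ t) s v eq =
    ⊥-elim (<⇒≢ (s≤s (≤-trans (length-++-≤ʳ v {s}) (length-++-≤ʳ (s ++ v) {t}))) (cong length eq))

  mirror-unique : ∀ u₁ u₂ → u₁ ++ reverse u₁ ≡ u₂ ++ reverse u₂ → u₁ ≡ u₂
  mirror-unique u₁ u₂ eq with ++-overlap u₁ (reverse u₁) u₂ (reverse u₂) eq
  ... | inj₁ (t , refl , eq′) with ++-absorbed t (reverse t) (reverse u₁) (trans eq′ (cong (t ++_) (reverse-++ u₁ t)))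
  ...   | refl , _ = sym (++-identityʳ u₁)
  mirror-unique u₁ u₂ eq | inj₂ (t , refl , eq′) with ++-absorbed t (reverse t) (reverse u₂) (trans eq′ (cong (t ++_) (reverse-++ u₂ t)))
  ...   | refl , _ = ++-identityʳ u₂

  module Dropping (a : A) where

    dropFirst : List A → List A
    dropFirst [] = []
    dropFirst (x ∷ xs) with a ≟ x
    ... | yes _ = xs
    ... | no _ = x ∷ dropFirst xs

    dropLast : List A → List A
    dropLast xs = reverse (dropFirst (reverse xs))

    dropOuter : List A → List A
    dropOuter xs = dropLast (dropFirst xs)

    dropFirst-⊆ : ∀ xs → dropFirst xs ⊆ xs
    dropFirst-⊆ [] = []
    dropFirst-⊆ (x ∷ xs) with a ≟ x
    ... | yes _ = x ∷ʳ ⊆-refl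
    ... | no _ = refl ∷ dropFirst-⊆ xs

    dropFirst-mono : ∀ {xs ys} → xs ⊆ ys → dropFirst xs ⊆ dropFirst ys
    dropFirst-mono [] = []
    dropFirst-mono (_∷ʳ_ {xs} y τ) with a ≟ y
    ... | yes _ = ⊆-trans (dropFirst-⊆ xs) τ
    ... | no _ = y ∷ʳ dropFirst-mono τ
    dropFirst-mono (_∷_ {x} refl τ) with a ≟ x
    ... | yes _ = τ
    ... | no _ = refl ∷ dropFirst-mono τ

    dropFirst-free : ∀ xs → Free a xs → dropFirst xs ≡ xs
    dropFirst-free [] _ = refl
    dropFirst-free (x ∷ xs) free with free-∷⁻ xs free
    ... | a≢x , free′ with a ≟ x
    ...   | yes a≡x = ⊥-elim (a≢x a≡x)
    ...   | no _ = cong (x ∷_) (dropFirst-free xs free′)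

    dropFirst-mid : ∀ xs ys → Free a xs → dropFirst (xs ++ a ∷ ys) ≡ xs ++ ys
    dropFirst-mid [] ys _ with a ≟ a
    ... | yes _ = refl
    ... | no a≢a = ⊥-elim (a≢a refl)
    dropFirst-mid (x ∷ xs) ys free with free-∷⁻ xs free
    ... | a≢x , free′ with a ≟ x
    ...   | yes a≡x = ⊥-elim (a≢x a≡x)
    ...   | no _ = cong (x ∷_) (dropFirst-mid xs ys free′)

    free⊆dropFirst : ∀ {xs ys} → Free a xs → xs ⊆ ys → xs ⊆ dropFirst ys
    free⊆dropFirst _ [] = []
    free⊆dropFirst free (y ∷ʳ τ) with a ≟ y
    ... | yes _ = τ
    ... | no _ = y ∷ʳ free⊆dropFirst free τ
    free⊆dropFirst free (_∷_ {x} {xs} refl τ) with free-∷⁻ xs free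
    ... | a≢x , free′ with a ≟ x
    ...   | yes a≡x = ⊥-elim (a≢x a≡x)
    ...   | no _ = refl ∷ free⊆dropFirst free′ τ

    dropLast-free : ∀ xs → Free a xs → dropLast xs ≡ xs
    dropLast-free xs free
      rewrite dropFirst-free (reverse xs) (free-reverse a xs free) = reverse-involutive xs

    dropLast-mid : ∀ xs ys → Free a ys → dropLast (xs ++ a ∷ ys) ≡ xs ++ ys
    dropLast-mid xs ys free = begin
      reverse (dropFirst (reverse (xs ++ a ∷ ys)))            ≡⟨ cong (reverse ∘ dropFirst) (reverse-mid a xs ys) ⟩
      reverse (dropFirst (reverse ys ++ a ∷ reverse xs))      ≡⟨ cong reverse (dropFirst-mid (reverse ys) (reverse xs) (free-reverse a ys free)) ⟩
      reverse (reverse ys ++ reverse xs)                      ≡⟨ reverse-++ (reverse ys) (reverse xs) ⟩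
      reverse (reverse xs) ++ reverse (reverse ys)            ≡⟨ cong₂ _++_ (reverse-involutive xs) (reverse-involutive ys) ⟩
      xs ++ ys                                                ∎
      where open ≡-Reasoning

    free⊆dropLast : ∀ {xs ys} → Free a xs → xs ⊆ ys → xs ⊆ dropLast ys
    free⊆dropLast {xs} free τ =
      subst (_⊆ _) (reverse-involutive xs) (reverse⁺ (free⊆dropFirst (free-reverse a xs free) (reverse⁺ τ)))

    dropOuter-mono : ∀ {xs ys} → xs ⊆ ys → dropOuter xs ⊆ dropOuter ys
    dropOuter-mono τ = reverse⁺ (dropFirst-mono (reverse⁺ (dropFirst-mono τ)))

    free⊆dropOuter : ∀ {xs ys} → Free a xs → xs ⊆ ys → xs ⊆ dropOuter ys
    free⊆dropOuter free τ = free⊆dropLast free (free⊆dropFirst free τ)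

  module Shapes (a : A) where

    open Dropping a

    free? : ∀ xs → Dec (Free a xs)
    free? xs = occ a xs ≟ℕ 0

    first-occurrence : ∀ p → ¬ Free a p → ∃[ y ] ∃[ m ] (p ≡ y ++ a ∷ m × Free a y)
    first-occurrence [] nf = ⊥-elim (nf refl)
    first-occurrence (x ∷ p) nf with a ≟ x
    ... | yes refl = [] , p , refl , refl
    ... | no a≢x with first-occurrence p nf
    ...   | y , m , refl , free-y = x ∷ y , m , refl , trans (occ-there y a≢x) free-y

    last-occurrence : ∀ m → ¬ Free a m → ∃[ m′ ] ∃[ z ] (m ≡ m′ ++ a ∷ z × Free a z)
    last-occurrence [] nf = ⊥-elim (nf refl)
    last-occurrence (x ∷ m) nf with free? m
    ... | no nf-m with last-occurrence m nf-m
    ...   | m′ , z , refl , free-z = x ∷ m′ , z , refl , free-z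
    last-occurrence (x ∷ m) nf | yes free-m with a ≟ x
    ...   | yes refl = [] , m , refl , free-m
    ...   | no _ = ⊥-elim (nf free-m)

    palindrome-mirror : ∀ s n → Free a s → Free a n → IsPalindrome (s ++ a ∷ n) → n ≡ reverse s
    palindrome-mirror s n free-s free-n pal
      with split-at-first-unique a s (reverse n) free-s (free-reverse a n free-n) (trans pal (reverse-mid a s n))
    ... | s≡n′ , _ = trans (sym (reverse-involutive n)) (cong reverse (sym s≡n′))

    palindrome-peel : ∀ y m z → Free a y → Free a z → IsPalindrome (y ++ a ∷ m ++ a ∷ z) →
                      z ≡ reverse y × IsPalindrome m
    palindrome-peel y m z free-y free-z pal
      with split-at-first-unique a y (reverse z) free-y (free-reverse a z free-z) (trans pal reversed)
      where
        reversed : reverse (y ++ a ∷ m ++ a ∷ z) ≡ reverse z ++ a ∷ reverse m ++ a ∷ reverse y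
        reversed = begin
          reverse (y ++ a ∷ m ++ a ∷ z)                ≡⟨ reverse-mid a y (m ++ a ∷ z) ⟩
          reverse (m ++ a ∷ z) ++ a ∷ reverse y        ≡⟨ cong (_++ a ∷ reverse y) (reverse-mid a m z) ⟩
          (reverse z ++ a ∷ reverse m) ++ a ∷ reverse y ≡⟨ ++-assoc (reverse z) (a ∷ reverse m) (a ∷ reverse y) ⟩
          reverse z ++ a ∷ reverse m ++ a ∷ reverse y  ∎
          where open ≡-Reasoning
    ... | refl , rest = sym (reverse-involutive z) ,
                        ++-cancelʳ (a ∷ z) m (reverse m) (trans rest (cong (λ t → reverse m ++ a ∷ t) (reverse-involutive z)))

    data PalShape (p : List A) : Set where
      one   : ∀ u → Free a u → p ≡ u ++ a ∷ reverse u → PalShape p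
      two   : ∀ y s → Free a y → Free a s → IsPalindrome s → p ≡ y ++ a ∷ s ++ a ∷ reverse y → PalShape p
      three : ∀ y s → Free a y → Free a s → p ≡ y ++ a ∷ s ++ a ∷ reverse s ++ a ∷ reverse y → PalShape p

    palShape : ∀ p → IsPalindrome p → ¬ Free a p → occ a p ≤ 3 → PalShape p
    palShape p pal nf le with first-occurrence p nf
    ... | y , m , refl , free-y with free? m
    ...   | yes free-m = one y free-y (cong (λ t → y ++ a ∷ t) (palindrome-mirror y m free-y free-m pal))
    ...   | no nf-m with last-occurrence m nf-m
    ...     | m′ , z , refl , free-z with palindrome-peel y m′ z free-y free-z pal
    ...       | refl , pal-m′ with free? m′
    ...         | yes free-m′ = two y m′ free-y free-m′ pal-m′ refl
    ...         | no nf-m′ with first-occurrence m′ nf-m′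
    ...           | s , n , refl , free-s = three y s free-y free-s shape
      where
        free-n : Free a n
        free-n = middle-free (occ a y) (occ a s) (occ a n) (occ a z)
                   (subst (_≤ 3) (occ-three-blocks) le)
          where
            occ-three-blocks : occ a (y ++ a ∷ (s ++ a ∷ n) ++ a ∷ z) ≡ occ a y + suc ((occ a s + suc (occ a n)) + suc (occ a z))
            occ-three-blocks rewrite occ-mid a y ((s ++ a ∷ n) ++ a ∷ z) | occ-mid a (s ++ a ∷ n) z | occ-mid a s n = refl
            middle-free : ∀ k l n′ r → k + suc ((l + suc n′) + suc r) ≤ 3 → n′ ≡ 0
            middle-free k l n′ r le′ with m+n≤o⇒n≤o k le′
            ... | s≤s le″ with m+n≤o⇒n≤o l (m+n≤o⇒m≤o (l + suc n′) (s≤s⁻¹ (subst (_≤ 2) (+-suc (l + suc n′) r) le″)))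
            ...   | s≤s le‴ = n≤0⇒n≡0 le‴
        shape : y ++ a ∷ (s ++ a ∷ n) ++ a ∷ z ≡ y ++ a ∷ s ++ a ∷ reverse s ++ a ∷ z
        shape = cong (λ t → y ++ a ∷ t) (trans (++-assoc s (a ∷ n) (a ∷ z))
                  (cong (λ t → s ++ a ∷ t ++ a ∷ z) (palindrome-mirror s n free-s free-n pal-m′)))

    dropOuter-single : ∀ x z → Free a x → Free a z → dropOuter (x ++ a ∷ z) ≡ x ++ z
    dropOuter-single x z free-x free-z = begin
      dropLast (dropFirst (x ++ a ∷ z))  ≡⟨ cong dropLast (dropFirst-mid x z free-x) ⟩
      dropLast (x ++ z)                  ≡⟨ dropLast-free (x ++ z) (free-++⁺ a x z free-x free-z) ⟩
      x ++ z                             ∎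
      where open ≡-Reasoning

    dropOuter-double : ∀ x m z → Free a x → Free a z → dropOuter (x ++ a ∷ m ++ a ∷ z) ≡ x ++ m ++ z
    dropOuter-double x m z free-x free-z = begin
      dropLast (dropFirst (x ++ a ∷ m ++ a ∷ z))  ≡⟨ cong dropLast (dropFirst-mid x (m ++ a ∷ z) free-x) ⟩
      dropLast (x ++ m ++ a ∷ z)                  ≡⟨ cong dropLast (sym (++-assoc x m (a ∷ z))) ⟩
      dropLast ((x ++ m) ++ a ∷ z)                ≡⟨ dropLast-mid (x ++ m) z free-z ⟩
      (x ++ m) ++ z                               ≡⟨ ++-assoc x m z ⟩
      x ++ m ++ z                                 ∎
      where open ≡-Reasoning

    palindrome-wrap : ∀ (z m : List A) → IsPalindrome m → IsPalindrome (z ++ m ++ reverse z)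
    palindrome-wrap z m pal = sym (begin
      reverse (z ++ m ++ reverse z)                   ≡⟨ reverse-++ z (m ++ reverse z) ⟩
      reverse (m ++ reverse z) ++ reverse z           ≡⟨ cong (_++ reverse z) (reverse-++ m (reverse z)) ⟩
      (reverse (reverse z) ++ reverse m) ++ reverse z ≡⟨ cong₂ (λ u v → (u ++ v) ++ reverse z) (reverse-involutive z) (sym pal) ⟩
      (z ++ m) ++ reverse z                           ≡⟨ ++-assoc z m (reverse z) ⟩
      z ++ m ++ reverse z                             ∎)
      where open ≡-Reasoning

    dropOuter-one : ∀ u → Free a u → dropOuter (u ++ a ∷ reverse u) ≡ u ++ reverse u
    dropOuter-one u free-u = dropOuter-single u (reverse u) free-u (free-reverse a u free-u)

    dropOuter-two : ∀ y s → Free a y → dropOuter (y ++ a ∷ s ++ a ∷ reverse y) ≡ y ++ s ++ reverse y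
    dropOuter-two y s free-y = dropOuter-double y s (reverse y) free-y (free-reverse a y free-y)

    dropOuter-three : ∀ y s → Free a y →
                      dropOuter (y ++ a ∷ s ++ a ∷ reverse s ++ a ∷ reverse y) ≡ y ++ (s ++ a ∷ reverse s) ++ reverse y
    dropOuter-three y s free-y =
      trans (cong (λ t → dropOuter (y ++ a ∷ t)) (sym (++-assoc s (a ∷ reverse s) (a ∷ reverse y))))
            (dropOuter-two y (s ++ a ∷ reverse s) free-y)

    dropOuter-palindrome : ∀ {p} → PalShape p → IsPalindrome (dropOuter p)
    dropOuter-palindrome (one u free-u refl) rewrite dropOuter-one u free-u = palindrome-wrap u [] refl
    dropOuter-palindrome (two y s free-y _ pal refl) rewrite dropOuter-two y s free-y = palindrome-wrap y s pal
    dropOuter-palindrome (three y s free-y _ refl) rewrite dropOuter-three y s free-y =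
      palindrome-wrap y (s ++ a ∷ reverse s) (palindrome-wrap s [ a ] refl)

    dropOuter-one-free : ∀ u → Free a u → Free a (dropOuter (u ++ a ∷ reverse u))
    dropOuter-one-free u free-u rewrite dropOuter-one u free-u = free-++⁺ a u (reverse u) free-u (free-reverse a u free-u)

    dropOuter-two-free : ∀ y s → Free a y → Free a s → Free a (dropOuter (y ++ a ∷ s ++ a ∷ reverse y))
    dropOuter-two-free y s free-y free-s rewrite dropOuter-two y s free-y =
      free-++⁺ a y (s ++ reverse y) free-y (free-++⁺ a s (reverse y) free-s (free-reverse a y free-y))

    dropOuter-three-nonfree : ∀ y s → Free a y → ¬ Free a (dropOuter (y ++ a ∷ s ++ a ∷ reverse s ++ a ∷ reverse y))
    dropOuter-three-nonfree y s free-y free rewrite dropOuter-three y s free-y =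
      free-mid a (y ++ s) (reverse s ++ reverse y)
        (subst (Free a) (trans (cong (y ++_) (++-assoc s (a ∷ reverse s) (reverse y))) (sym (++-assoc y s _))) free)

  ∈-subwords⁻ : ∀ {u} xs → u ∈ subwords xs → u ⊆ xs
  ∈-subwords⁻ [] (here refl) = []
  ∈-subwords⁻ (x ∷ xs) m with ∈-++⁻ (map (x ∷_) (subwords xs)) m
  ... | inj₁ m′ with ∈-map⁻ (x ∷_) m′
  ...   | u , m″ , refl = refl ∷ ∈-subwords⁻ xs m″
  ∈-subwords⁻ (x ∷ xs) m | inj₂ m′ = x ∷ʳ ∈-subwords⁻ xs m′

  ∈-subwords⁺ : ∀ {u xs} → u ⊆ xs → u ∈ subwords xs
  ∈-subwords⁺ [] = here refl
  ∈-subwords⁺ (_∷ʳ_ {ys = ys} y τ) = ∈-++⁺ʳ (map (y ∷_) (subwords ys)) (∈-subwords⁺ τ)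
  ∈-subwords⁺ (_∷_ {x} refl τ) = ∈-++⁺ˡ (∈-map⁺ (x ∷_) (∈-subwords⁺ τ))

  PalSubword : List A → Set
  PalSubword u = NonEmpty u × IsPalindrome u

  palSubword? : ∀ u → Dec (PalSubword u)
  palSubword? u = nonEmpty? _≟_ u ×-dec isPalindrome? _≟_ u

  palSubwords : List A → List (List A)
  palSubwords v = deduplicate (≡-dec _≟_) (filter palSubword? (subwords v))

  ∈-palSubwords⁻ : ∀ {p} v → p ∈ palSubwords v → p ⊆ v × PalSubword p
  ∈-palSubwords⁻ v m with ∈-filter⁻ palSubword? (∈-deduplicate⁻ (≡-dec _≟_) (filter palSubword? (subwords v)) m)
  ... | m′ , pal = ∈-subwords⁻ v m′ , pal

  ∈-palSubwords⁺ : ∀ {p v} → p ⊆ v → PalSubword p → p ∈ palSubwords v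
  ∈-palSubwords⁺ τ pal = ∈-deduplicate⁺ (≡-dec _≟_) (∈-filter⁺ palSubword? (∈-subwords⁺ τ) pal)

  palSubwords-unique : ∀ v → Unique (palSubwords v)
  palSubwords-unique v = deduplicate-! (≡-dec _≟_) (filter palSubword? (subwords v))

  module Contraction (a : A) (v₁ v₂ v₃ v₄ : List A) (a-free : Free a (v₁ ++ v₂ ++ v₃ ++ v₄))
                     (sparse : ∀ b → b ≢ a → occ b (v₁ ++ a ∷ v₂ ++ a ∷ v₃ ++ a ∷ v₄) ≤ 2) where

    open Dropping a
    open Shapes a
    open import Algebra.Solver.Monoid (++-monoid A) using (_⊕_; _⊜_) renaming (solve to ++-solve)

    free₁ : Free a v₁
    free₁ = proj₁ (free-++⁻ a v₁ _ a-free)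

    free₂₃₄ : Free a (v₂ ++ v₃ ++ v₄)
    free₂₃₄ = proj₂ (free-++⁻ a v₁ _ a-free)

    free₂ : Free a v₂
    free₂ = proj₁ (free-++⁻ a v₂ _ free₂₃₄)

    free₃₄ : Free a (v₃ ++ v₄)
    free₃₄ = proj₂ (free-++⁻ a v₂ _ free₂₃₄)

    free₃ : Free a v₃
    free₃ = proj₁ (free-++⁻ a v₃ v₄ free₃₄)

    free₄ : Free a v₄
    free₄ = proj₂ (free-++⁻ a v₃ v₄ free₃₄)

    w w′ : List A
    w = v₁ ++ a ∷ v₂ ++ a ∷ v₃ ++ a ∷ v₄
    w′ = v₁ ++ v₂ ++ a ∷ v₃ ++ v₄

    occ-w : occ a w ≡ 3
    occ-w rewrite occ-mid a v₁ (v₂ ++ a ∷ v₃ ++ a ∷ v₄) | occ-mid a v₂ (v₃ ++ a ∷ v₄) | occ-mid a v₃ v₄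
                | free₁ | free₂ | free₃ | free₄ = refl

    dropOuter-w : dropOuter w ≡ w′
    dropOuter-w = begin
      dropOuter (v₁ ++ a ∷ v₂ ++ a ∷ v₃ ++ a ∷ v₄)    ≡⟨ cong (λ t → dropOuter (v₁ ++ a ∷ t)) (sym (++-assoc v₂ (a ∷ v₃) (a ∷ v₄))) ⟩
      dropOuter (v₁ ++ a ∷ (v₂ ++ a ∷ v₃) ++ a ∷ v₄)  ≡⟨ dropOuter-double v₁ (v₂ ++ a ∷ v₃) v₄ free₁ free₄ ⟩
      v₁ ++ (v₂ ++ a ∷ v₃) ++ v₄                      ≡⟨ cong (v₁ ++_) (++-assoc v₂ (a ∷ v₃) v₄) ⟩
      w′                                              ∎
      where open ≡-Reasoning

    free⊆w⇒⊆w′ : ∀ {p} → Free a p → p ⊆ w → p ⊆ w′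
    free⊆w⇒⊆w′ free τ = subst (_ ⊆_) dropOuter-w (free⊆dropOuter free τ)

    dropOuter⊆w′ : ∀ {p} → p ⊆ w → dropOuter p ⊆ w′
    dropOuter⊆w′ τ = subst (_ ⊆_) dropOuter-w (dropOuter-mono τ)

    ⊆w′-through-a : ∀ {u r} → u ⊆ v₁ ++ v₂ → r ⊆ v₃ ++ v₄ → u ++ a ∷ r ⊆ w′
    ⊆w′-through-a τ σ = subst (_ ⊆_) (++-assoc v₁ v₂ (a ∷ v₃ ++ v₄)) (++⁺ τ (refl ∷ σ))

    occ-w-tail : occ a ((v₁ ++ v₂) ++ v₃ ++ a ∷ v₄) ≡ 1
    occ-w-tail rewrite occ-++ a (v₁ ++ v₂) (v₃ ++ a ∷ v₄) | occ-++ a v₁ v₂ | occ-mid a v₃ v₄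
                     | free₁ | free₂ | free₃ | free₄ = refl

    aa⊆w⇒a⊆w′ : ∀ u r → Free a u → Free a r → u ++ a ∷ a ∷ r ⊆ w → u ++ a ∷ r ⊆ w′
    aa⊆w⇒a⊆w′ u r free-u free-r τ with ⊆-at-letter u v₁ free-u free₁ τ
    ... | inj₁ (u⊆v₁ , τ′) = ⊆w′-through-a (++⁺ʳ v₂ u⊆v₁) (⊆-skip-letter v₃ v₄ free-r (∷⊆-after-free v₂ free₂ τ′))
    ... | inj₂ τ′ with ⊆-at-letter u (v₁ ++ v₂) free-u (free-++⁺ a v₁ v₂ free₁ free₂)
                         (subst (_ ⊆_) (sym (++-assoc v₁ v₂ _)) τ′)
    ...   | inj₁ (u⊆v₁v₂ , τ″) = ⊆w′-through-a u⊆v₁v₂ (++⁺ˡ v₃ (∷⊆-after-free v₃ free₃ τ″))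
    ...   | inj₂ τ″ with subst (2 ≤_) occ-w-tail (≤-trans (two≤occ a u [] r) (occ-mono a τ″))
    ...     | s≤s ()

    crowded : ∀ c y P Q → a ≢ c → Around₂ c (y ++ [ a ]) P (a ∷ reverse y) ⊆ w →
              Around₂ c y Q (reverse y) ⊆ w → 2 ≤ occ a Q → ⊥
    crowded c y P Q a≢c τ σ two≤Q with ≤-trans four≤ (subst (_ ≤_) occ-w (occ-mono a mixed))
      where
        mixed : Around₂ c (y ++ [ a ]) Q (a ∷ reverse y) ⊆ w
        mixed = around₂-mix c (y ++ [ a ]) P (a ∷ reverse y) y Q (reverse y) (sparse c (a≢c ∘ sym)) τ σ
        four≤ : 4 ≤ occ a (Around₂ c (y ++ [ a ]) Q (a ∷ reverse y))
        four≤ rewrite occ-around₂-≢ c (y ++ [ a ]) Q (a ∷ reverse y) a≢c | occ-mid a y [] | occ-here a (reverse y) =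
          +-mono-≤ (m≤n+m 1 (occ a y)) (+-mono-≤ two≤Q (s≤s z≤n))
    ... | s≤s (s≤s (s≤s ()))

    one-vs-two-nested : ∀ y t → Free a y → Free a (y ++ t) → (y ++ t) ++ a ∷ reverse (y ++ t) ⊆ w →
                        y ++ a ∷ (t ++ reverse t) ++ a ∷ reverse y ⊆ w → (y ++ t) ++ a ∷ reverse (y ++ t) ⊆ w′
    one-vs-two-nested y [] free-y _ _ σ =
      subst (λ z → z ++ a ∷ reverse z ⊆ w′) (sym (++-identityʳ y)) (aa⊆w⇒a⊆w′ y (reverse y) free-y (free-reverse a y free-y) σ)
    one-vs-two-nested y (c ∷ t) free-y free-yt τ σ =
      subst (_⊆ w′) (sym p-shape) (subst (_⊆ w′) dropOuter-mixed (dropOuter⊆w′ mixed))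
      where
        a≢c : a ≢ c
        a≢c = free-mid⇒≢ y t free-yt
        M : List A
        M = t ++ a ∷ reverse t
        p-shape : (y ++ c ∷ t) ++ a ∷ reverse (y ++ c ∷ t) ≡ Around₂ c y M (reverse y)
        p-shape rewrite reverse-mid c y t =
          ++-solve 6 (λ Y C T RT RY X → (Y ⊕ C ⊕ T) ⊕ X ⊕ (RT ⊕ C ⊕ RY) ⊜ Y ⊕ C ⊕ (T ⊕ X ⊕ RT) ⊕ C ⊕ RY)
            refl y [ c ] t (reverse t) (reverse y) [ a ]
        q-shape : y ++ a ∷ (c ∷ t ++ reverse (c ∷ t)) ++ a ∷ reverse y ≡ Around₂ c (y ++ [ a ]) (t ++ reverse t) (a ∷ reverse y)
        q-shape rewrite unfold-reverse c t =
          ++-solve 6 (λ Y C T RT RY X → Y ⊕ X ⊕ (C ⊕ T ⊕ (RT ⊕ C)) ⊕ X ⊕ RY ⊜ (Y ⊕ X) ⊕ C ⊕ (T ⊕ RT) ⊕ C ⊕ (X ⊕ RY))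
            refl y [ c ] t (reverse t) (reverse y) [ a ]
        mixed : Around₂ c (y ++ [ a ]) M (a ∷ reverse y) ⊆ w
        mixed = around₂-mix c (y ++ [ a ]) (t ++ reverse t) (a ∷ reverse y) y M (reverse y)
                  (sparse c (a≢c ∘ sym)) (subst (_⊆ w) q-shape σ) (subst (_⊆ w) p-shape τ)
        dropOuter-mixed : dropOuter (Around₂ c (y ++ [ a ]) M (a ∷ reverse y)) ≡ Around₂ c y M (reverse y)
        dropOuter-mixed = begin
          dropOuter (Around₂ c (y ++ [ a ]) M (a ∷ reverse y))
            ≡⟨ cong dropOuter (++-solve 5 (λ Y C M RY X → (Y ⊕ X) ⊕ C ⊕ M ⊕ C ⊕ X ⊕ RY ⊜ Y ⊕ X ⊕ (C ⊕ M ⊕ C) ⊕ X ⊕ RY)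
                 refl y [ c ] M (reverse y) [ a ]) ⟩
          dropOuter (y ++ a ∷ (c ∷ M ++ [ c ]) ++ a ∷ reverse y)
            ≡⟨ dropOuter-double y (c ∷ M ++ [ c ]) (reverse y) free-y (free-reverse a y free-y) ⟩
          y ++ (c ∷ M ++ [ c ]) ++ reverse y
            ≡⟨ ++-solve 4 (λ Y C M RY → Y ⊕ (C ⊕ M ⊕ C) ⊕ RY ⊜ Y ⊕ C ⊕ M ⊕ C ⊕ RY) refl y [ c ] M (reverse y) ⟩
          Around₂ c y M (reverse y)
            ∎
          where open ≡-Reasoning

    one-vs-two : ∀ u y s → Free a u → Free a y → u ++ reverse u ≡ y ++ s ++ reverse y →
                 u ++ a ∷ reverse u ⊆ w → y ++ a ∷ s ++ a ∷ reverse y ⊆ w → u ++ a ∷ reverse u ⊆ w′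
    one-vs-two u y s free-u free-y eq τ σ with ++-overlap u (reverse u) y (s ++ reverse y) eq
    ... | inj₁ (t , refl , eq′) with ++-absorbed t (s ++ reverse t) (reverse u) (trans eq′ regroup)
      where
        regroup : t ++ s ++ reverse (u ++ t) ≡ t ++ (s ++ reverse t) ++ reverse u
        regroup = cong (t ++_) (trans (cong (s ++_) (reverse-++ u t)) (sym (++-assoc s (reverse t) (reverse u))))
    ...   | refl , s++[]≡[] with trans (sym (++-identityʳ s)) s++[]≡[]
    ...     | refl = aa⊆w⇒a⊆w′ u (reverse u) free-u (free-reverse a u free-u)
                       (subst (λ z → z ++ a ∷ a ∷ reverse z ⊆ w) (++-identityʳ u) σ)
    one-vs-two u y s free-u free-y eq τ σ | inj₂ (t , refl , eq′)
      with ++-cancelʳ (reverse y) s (t ++ reverse t) (trans eq′ regroup)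
      where
        regroup : t ++ reverse (y ++ t) ≡ (t ++ reverse t) ++ reverse y
        regroup = trans (cong (t ++_) (reverse-++ y t)) (sym (++-assoc t (reverse t) (reverse y)))
    ... | refl = one-vs-two-nested y t free-y free-u τ σ

    two-vs-two : ∀ y s t s′ → Free a (y ++ t) → s ++ reverse y ≡ t ++ s′ ++ reverse (y ++ t) →
                 y ++ a ∷ s ++ a ∷ reverse y ⊆ w → (y ++ t) ++ a ∷ s′ ++ a ∷ reverse (y ++ t) ⊆ w →
                 y ++ a ∷ s ++ a ∷ reverse y ≡ (y ++ t) ++ a ∷ s′ ++ a ∷ reverse (y ++ t)
    two-vs-two y s [] s′ _ eq _ _ rewrite ++-identityʳ y | ++-cancelʳ (reverse y) s s′ eq = refl
    two-vs-two y s (c ∷ t) s′ free-yt eq τ σ =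
      ⊥-elim (crowded c y (t ++ s′ ++ reverse t) (t ++ a ∷ s′ ++ a ∷ reverse t) a≢c
                (subst (_⊆ w) p-shape τ) (subst (_⊆ w) q-shape σ) (two≤occ a t s′ (reverse t)))
      where
        a≢c : a ≢ c
        a≢c = free-mid⇒≢ y t free-yt
        s-shape : s ≡ c ∷ t ++ s′ ++ reverse t ++ [ c ]
        s-shape = ++-cancelʳ (reverse y) s _ (trans eq (trans (cong (λ z → c ∷ t ++ s′ ++ z) (reverse-mid c y t))
                    (++-solve 5 (λ C T S RT RY → C ⊕ T ⊕ S ⊕ RT ⊕ C ⊕ RY ⊜ (C ⊕ T ⊕ S ⊕ RT ⊕ C) ⊕ RY)
                       refl [ c ] t s′ (reverse t) (reverse y))))
        p-shape : y ++ a ∷ s ++ a ∷ reverse y ≡ Around₂ c (y ++ [ a ]) (t ++ s′ ++ reverse t) (a ∷ reverse y)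
        p-shape rewrite s-shape =
          ++-solve 7 (λ Y C T S RT RY X → Y ⊕ X ⊕ (C ⊕ T ⊕ S ⊕ RT ⊕ C) ⊕ X ⊕ RY ⊜ (Y ⊕ X) ⊕ C ⊕ (T ⊕ S ⊕ RT) ⊕ C ⊕ (X ⊕ RY))
            refl y [ c ] t s′ (reverse t) (reverse y) [ a ]
        q-shape : (y ++ c ∷ t) ++ a ∷ s′ ++ a ∷ reverse (y ++ c ∷ t) ≡ Around₂ c y (t ++ a ∷ s′ ++ a ∷ reverse t) (reverse y)
        q-shape rewrite reverse-mid c y t =
          ++-solve 7 (λ Y C T S RT RY X → (Y ⊕ C ⊕ T) ⊕ X ⊕ S ⊕ X ⊕ (RT ⊕ C ⊕ RY) ⊜ Y ⊕ C ⊕ (T ⊕ X ⊕ S ⊕ X ⊕ RT) ⊕ C ⊕ RY)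
            refl y [ c ] t s′ (reverse t) (reverse y) [ a ]

    three-vs-three : ∀ y t s → Free a (y ++ t) →
                     y ++ a ∷ (t ++ s) ++ a ∷ reverse (t ++ s) ++ a ∷ reverse y ⊆ w →
                     (y ++ t) ++ a ∷ s ++ a ∷ reverse s ++ a ∷ reverse (y ++ t) ⊆ w →
                     y ++ a ∷ (t ++ s) ++ a ∷ reverse (t ++ s) ++ a ∷ reverse y ≡
                     (y ++ t) ++ a ∷ s ++ a ∷ reverse s ++ a ∷ reverse (y ++ t)
    three-vs-three y [] s _ _ _ rewrite ++-identityʳ y = refl
    three-vs-three y (c ∷ t) s free-yt τ σ =
      ⊥-elim (crowded c y (t ++ s ++ a ∷ reverse s ++ reverse t) (t ++ a ∷ s ++ a ∷ reverse s ++ a ∷ reverse t) a≢c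
                (subst (_⊆ w) p-shape τ) (subst (_⊆ w) q-shape σ) (two≤occ a t s (reverse s ++ a ∷ reverse t)))
      where
        a≢c : a ≢ c
        a≢c = free-mid⇒≢ y t free-yt
        reverse-cts : reverse (c ∷ t ++ s) ≡ reverse s ++ reverse t ++ [ c ]
        reverse-cts = trans (unfold-reverse c (t ++ s)) (trans (cong (_++ [ c ]) (reverse-++ t s)) (++-assoc (reverse s) (reverse t) [ c ]))
        p-shape : y ++ a ∷ (c ∷ t ++ s) ++ a ∷ reverse (c ∷ t ++ s) ++ a ∷ reverse y ≡
                  Around₂ c (y ++ [ a ]) (t ++ s ++ a ∷ reverse s ++ reverse t) (a ∷ reverse y)
        p-shape rewrite reverse-cts =
          ++-solve 8 (λ Y C T S RS RT RY X → Y ⊕ X ⊕ (C ⊕ T ⊕ S) ⊕ X ⊕ (RS ⊕ RT ⊕ C) ⊕ X ⊕ RY ⊜ (Y ⊕ X) ⊕ C ⊕ (T ⊕ S ⊕ X ⊕ RS ⊕ RT) ⊕ C ⊕ (X ⊕ RY))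
            refl y [ c ] t s (reverse s) (reverse t) (reverse y) [ a ]
        q-shape : (y ++ c ∷ t) ++ a ∷ s ++ a ∷ reverse s ++ a ∷ reverse (y ++ c ∷ t) ≡
                  Around₂ c y (t ++ a ∷ s ++ a ∷ reverse s ++ a ∷ reverse t) (reverse y)
        q-shape rewrite reverse-mid c y t =
          ++-solve 8 (λ Y C T S RS RT RY X → (Y ⊕ C ⊕ T) ⊕ X ⊕ S ⊕ X ⊕ RS ⊕ X ⊕ (RT ⊕ C ⊕ RY) ⊜ Y ⊕ C ⊕ (T ⊕ X ⊕ S ⊕ X ⊕ RS ⊕ X ⊕ RT) ⊕ C ⊕ RY)
            refl y [ c ] t s (reverse s) (reverse t) (reverse y) [ a ]

    palShape-w : ∀ {p} → p ⊆ w → IsPalindrome p → ¬ p ⊆ w′ → PalShape p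
    palShape-w {p} τ pal p⊈w′ =
      palShape p pal (λ free → p⊈w′ (free⊆w⇒⊆w′ free τ)) (subst (occ a p ≤_) occ-w (occ-mono a τ))

    dropOuter-empty : ∀ {p} → PalShape p → ¬ p ⊆ w′ → dropOuter p ≡ [] → p ≡ a ∷ a ∷ []
    dropOuter-empty (one [] _ refl) p⊈w′ _ = ⊥-elim (p⊈w′ (⊆w′-through-a ([]⊆-universal _) ([]⊆-universal _)))
    dropOuter-empty (one (x ∷ u) free-u refl) _ eq with trans (sym (dropOuter-one (x ∷ u) free-u)) eq
    ... | ()
    dropOuter-empty (two [] [] _ _ _ refl) _ _ = refl
    dropOuter-empty (two [] (x ∷ s) free-y _ _ refl) _ eq with trans (sym (dropOuter-two [] (x ∷ s) free-y)) eq
    ... | ()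
    dropOuter-empty (two (x ∷ y) s free-y _ _ refl) _ eq with trans (sym (dropOuter-two (x ∷ y) s free-y)) eq
    ... | ()
    dropOuter-empty (three y s free-y _ refl) _ eq = ⊥-elim (dropOuter-three-nonfree y s free-y (cong (occ a) eq))

    dropOuter-injective : ∀ {p₁ p₂} → PalShape p₁ → PalShape p₂ → p₁ ⊆ w → p₂ ⊆ w → ¬ p₁ ⊆ w′ → ¬ p₂ ⊆ w′ →
                          dropOuter p₁ ≡ dropOuter p₂ → p₁ ≡ p₂
    dropOuter-injective (one u₁ free-u₁ refl) (one u₂ free-u₂ refl) _ _ _ _ eq =
      cong (λ u → u ++ a ∷ reverse u)
        (mirror-unique u₁ u₂ (trans (sym (dropOuter-one u₁ free-u₁)) (trans eq (dropOuter-one u₂ free-u₂))))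
    dropOuter-injective (one u free-u refl) (two y s free-y _ _ refl) τ σ p⊈w′ _ eq =
      ⊥-elim (p⊈w′ (one-vs-two u y s free-u free-y (trans (sym (dropOuter-one u free-u)) (trans eq (dropOuter-two y s free-y))) τ σ))
    dropOuter-injective (two y s free-y _ _ refl) (one u free-u refl) τ σ _ p⊈w′ eq =
      ⊥-elim (p⊈w′ (one-vs-two u y s free-u free-y (trans (sym (dropOuter-one u free-u)) (trans (sym eq) (dropOuter-two y s free-y))) σ τ))
    dropOuter-injective (two y₁ s₁ free-y₁ _ _ refl) (two y₂ s₂ free-y₂ _ _ refl) τ σ _ _ eq
      with ++-overlap y₁ (s₁ ++ reverse y₁) y₂ (s₂ ++ reverse y₂)
             (trans (sym (dropOuter-two y₁ s₁ free-y₁)) (trans eq (dropOuter-two y₂ s₂ free-y₂)))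
    ... | inj₁ (t , refl , eq′) = two-vs-two y₁ s₁ t s₂ free-y₂ eq′ τ σ
    ... | inj₂ (t , refl , eq′) = sym (two-vs-two y₂ s₂ t s₁ free-y₁ eq′ σ τ)
    dropOuter-injective (three y₁ s₁ free-y₁ free-s₁ refl) (three y₂ s₂ free-y₂ free-s₂ refl) τ σ _ _ eq
      with split-at-first-unique a (y₁ ++ s₁) (y₂ ++ s₂) (free-++⁺ a y₁ s₁ free-y₁ free-s₁) (free-++⁺ a y₂ s₂ free-y₂ free-s₂)
             (trans (regroup y₁ s₁) (trans (sym (dropOuter-three y₁ s₁ free-y₁))
               (trans eq (trans (dropOuter-three y₂ s₂ free-y₂) (sym (regroup y₂ s₂))))))
      where
        regroup : ∀ y s → (y ++ s) ++ a ∷ reverse s ++ reverse y ≡ y ++ (s ++ a ∷ reverse s) ++ reverse y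
        regroup y s = ++-solve 4 (λ Y S RS RY → (Y ⊕ S) ⊕ RS ⊕ RY ⊜ Y ⊕ (S ⊕ RS) ⊕ RY) refl y s (a ∷ reverse s) (reverse y)
    ... | eq′ , _ with ++-overlap y₁ s₁ y₂ s₂ eq′
    ...   | inj₁ (t , refl , refl) = three-vs-three y₁ t s₂ free-y₂ τ σ
    ...   | inj₂ (t , refl , refl) = sym (three-vs-three y₂ t s₁ free-y₁ σ τ)
    dropOuter-injective (one u free-u refl) (three y s free-y _ refl) _ _ _ _ eq =
      ⊥-elim (dropOuter-three-nonfree y s free-y (subst (Free a) eq (dropOuter-one-free u free-u)))
    dropOuter-injective (two y′ s′ free-y′ free-s′ _ refl) (three y s free-y _ refl) _ _ _ _ eq =
      ⊥-elim (dropOuter-three-nonfree y s free-y (subst (Free a) eq (dropOuter-two-free y′ s′ free-y′ free-s′)))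
    dropOuter-injective (three y s free-y _ refl) (one u free-u refl) _ _ _ _ eq =
      ⊥-elim (dropOuter-three-nonfree y s free-y (subst (Free a) (sym eq) (dropOuter-one-free u free-u)))
    dropOuter-injective (three y s free-y _ refl) (two y′ s′ free-y′ free-s′ _ refl) _ _ _ _ eq =
      ⊥-elim (dropOuter-three-nonfree y s free-y (subst (Free a) (sym eq) (dropOuter-two-free y′ s′ free-y′ free-s′)))

    data Code : Set where
      kept       : List A → Code
      contracted : List A → Code
      aa         : Code

    -- The decisions are arguments so that injectivity can be proved by matching on them.
    encodeWith : ∀ p → Dec (p ⊆ w′) → Dec (dropOuter p ≡ []) → Code
    encodeWith p (yes _) _ = kept p
    encodeWith p (no _) (yes _) = aa
    encodeWith p (no _) (no _) = contracted (dropOuter p)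

    encode : List A → Code
    encode p = encodeWith p (p ⊆? w′) (≡-dec _≟_ (dropOuter p) [])

    codes : List Code
    codes = map kept (palSubwords w′) ++ map contracted (palSubwords w′) ++ [ aa ]

    length-codes : length codes ≡ 2 * SP _≟_ w′ + 1
    length-codes rewrite length-++ (map kept (palSubwords w′)) {map contracted (palSubwords w′) ++ [ aa ]}
                       | length-++ (map contracted (palSubwords w′)) {[ aa ]}
                       | length-map kept (palSubwords w′) | length-map contracted (palSubwords w′) =
      solve 1 (λ n → n :+ (n :+ con 1) := con 2 :* n :+ con 1) refl (SP _≟_ w′)
      where open +-*-Solver

    encodeWith-∈ : ∀ {p} → p ⊆ w → PalSubword p → ∀ d₁ d₂ → encodeWith p d₁ d₂ ∈ codes
    encodeWith-∈ τ pal (yes τ′) _ = ∈-++⁺ˡ (∈-map⁺ kept (∈-palSubwords⁺ τ′ pal))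
    encodeWith-∈ τ pal (no _) (yes _) =
      ∈-++⁺ʳ (map kept (palSubwords w′)) (∈-++⁺ʳ (map contracted (palSubwords w′)) (here refl))
    encodeWith-∈ τ (_ , pal) (no τ̸) (no nonempty) =
      ∈-++⁺ʳ (map kept (palSubwords w′)) (∈-++⁺ˡ (∈-map⁺ contracted
        (∈-palSubwords⁺ (dropOuter⊆w′ τ) (nonempty , dropOuter-palindrome (palShape-w τ pal τ̸)))))

    encodeWith-injective : ∀ {p₁ p₂} → p₁ ⊆ w → IsPalindrome p₁ → p₂ ⊆ w → IsPalindrome p₂ →
                           ∀ d₁ d₂ d₁′ d₂′ → encodeWith p₁ d₁ d₂ ≡ encodeWith p₂ d₁′ d₂′ → p₁ ≡ p₂
    encodeWith-injective _ _ _ _ (yes _) _ (yes _) _ refl = refl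
    encodeWith-injective τ₁ pal₁ τ₂ pal₂ (no τ̸₁) (yes e₁) (no τ̸₂) (yes e₂) _ =
      trans (dropOuter-empty (palShape-w τ₁ pal₁ τ̸₁) τ̸₁ e₁) (sym (dropOuter-empty (palShape-w τ₂ pal₂ τ̸₂) τ̸₂ e₂))
    encodeWith-injective τ₁ pal₁ τ₂ pal₂ (no τ̸₁) (no _) (no τ̸₂) (no _) eq =
      dropOuter-injective (palShape-w τ₁ pal₁ τ̸₁) (palShape-w τ₂ pal₂ τ̸₂) τ₁ τ₂ τ̸₁ τ̸₂ (contracted-injective eq)
      where
        contracted-injective : ∀ {q₁ q₂} → contracted q₁ ≡ contracted q₂ → q₁ ≡ q₂
        contracted-injective refl = refl
    encodeWith-injective _ _ _ _ (yes _) _ (no _) (yes _) ()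
    encodeWith-injective _ _ _ _ (yes _) _ (no _) (no _) ()
    encodeWith-injective _ _ _ _ (no _) (yes _) (yes _) _ ()
    encodeWith-injective _ _ _ _ (no _) (no _) (yes _) _ ()
    encodeWith-injective _ _ _ _ (no _) (yes _) (no _) (no _) ()
    encodeWith-injective _ _ _ _ (no _) (no _) (no _) (yes _) ()

    encode-∈ : ∀ {p} → p ∈ palSubwords w → encode p ∈ codes
    encode-∈ {p} m = let τ , pal = ∈-palSubwords⁻ w m in encodeWith-∈ τ pal (p ⊆? w′) _

    encode-injective : ∀ {p₁ p₂} → p₁ ∈ palSubwords w → p₂ ∈ palSubwords w → encode p₁ ≡ encode p₂ → p₁ ≡ p₂
    encode-injective {p₁} {p₂} m₁ m₂ =
      let τ₁ , _ , pal₁ = ∈-palSubwords⁻ w m₁ ; τ₂ , _ , pal₂ = ∈-palSubwords⁻ w m₂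
      in encodeWith-injective τ₁ pal₁ τ₂ pal₂ (p₁ ⊆? w′) _ (p₂ ⊆? w′) _

lemma5p2 : {Σ : Set} (_≟_ : DecidableEquality Σ) (a : Σ) (v₁ v₂ v₃ v₄ : List Σ)
    → count _≟_ a (v₁ ++ v₂ ++ v₃ ++ v₄) ≡ 0
    → ((b : Σ) → b ≢ a → count _≟_ b (v₁ ++ a ∷ v₂ ++ a ∷ v₃ ++ a ∷ v₄) ≤ 2)
    → SP _≟_ (v₁ ++ a ∷ v₂ ++ a ∷ v₃ ++ a ∷ v₄)
      ≤ 2 * SP _≟_ (v₁ ++ v₂ ++ a ∷ v₃ ++ v₄) + 1
lemma5p2 _≟_ a v₁ v₂ v₃ v₄ a-free sparse =
  subst (SP _≟_ w ≤_) length-codes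
    (length-≤-of-injective encode (palSubwords w) codes (palSubwords-unique w) encode-∈ encode-injective)
  where
    open Words _≟_
    open Contraction a v₁ v₂ v₃ v₄ a-free sparse
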